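{- Let $\mathcal{R}$ be a terminating TRS, and for a term $s$ let $$f(s) := \max\{\mathrm{dh}(t^\sharp,\to_{\mathrm{DP}(\mathcal{R})/\mathcal{R}})\mid t \text{ a subterm of } s\}.$$ Then there exists $d\in\mathbb{N}$ such that for all terms $t$, $$\mathrm{pdp}(t,\to_{\mathcal{R}})\leqslant |t|\cdot 2^{d\cdot(f(t)+1)}.$$
   Context: $|t|$ is the number of occurrences of function symbols and variables in $t$. The depth $\mathrm{dp}(t)$ is $0$ if $t$ is a variable or a constant, and $1+\max_i \mathrm{dp}(t_i)$ if $t=f(t_1,\dots,t_n)$ with $n\geqslant 1$. The potential depth is $\mathrm{pdp}(t,\to)=\max\{\mathrm{dp}(u)\mid t\to^* u\}$. $\mathrm{dh}(s,\to)=\max\{n\mid\exists u,\ s\to^n u\}$. Defined symbols are roots of left-hand sides of rules of the finite TRS $\mathcal{R}$. For each $f$ let $f^\sharp$ be a fresh symbol of the same arity; $t^\sharp=t$ for a variable $t$, and $t^\sharp=f^\sharp(t_1,\dots,t_n)$ for $t=f(t_1,\dots,t_n)$. $$\mathrm{DP}(\mathcal{R})=\{l^\sharp\to u^\sharp\mid l\to r\in\mathcal{R},\ u \text{ a subterm of } r \text{ with defined root},\ u \text{ not a proper subterm of } l\}.$$ $\to_{\mathcal{P}/\mathcal{S}}=\to_{\mathcal{S}}^*\cdot\to_{\mathcal{P}}\cdot\to_{\mathcal{S}}^*$. -}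

module Defs where

open import Data.Nat using (ℕ; zero; suc; _+_; _⊔_)
open import Data.Fin using (Fin)
open import Data.Vec using (Vec; []; _∷_; lookup; _[_]≔_)
open import Data.Vec.Membership.Propositional using () renaming (_∈_ to _∈ᵥ_)
open import Data.List using (List)
open import Data.List.Membership.Propositional using (_∈_)
open import Data.Product using (Σ; ∃; _×_; _,_)
open import Data.Sum using (_⊎_; inj₁; inj₂; [_,_]′)
open import Relation.Binary.PropositionalEquality using (_≡_)
open import Relation.Binary.Construct.Closure.ReflexiveTransitive using (Star)
open import Relation.Nullary using (¬_)
open import Induction.WellFounded using (WellFounded)

record Sig : Set₁ where
  field
    Sym : Set
    ar  : Sym → ℕ

Var : Set
Var = ℕ

module Terms (S : Sig) where
  open Sig S

  data Term : Set where
    var : Var → Term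
    fun : (f : Sym) → Vec Term (ar f) → Term

  Subst : Set
  Subst = Var → Term

  mutual
    _⟨_⟩ : Term → Subst → Term
    var x ⟨ σ ⟩ = σ x
    fun f ts ⟨ σ ⟩ = fun f (subs ts σ)

    subs : ∀ {n} → Vec Term n → Subst → Vec Term n
    subs [] σ = []
    subs (t ∷ ts) σ = (t ⟨ σ ⟩) ∷ subs ts σ

  mutual
    size : Term → ℕ
    size (var x) = 1
    size (fun f ts) = suc (sizes ts)

    sizes : ∀ {n} → Vec Term n → ℕ
    sizes [] = 0
    sizes (t ∷ ts) = size t + sizes ts

  -- dp : 0 for variables and constants, 1 + max dp of arguments otherwise
  mutual
    dp : Term → ℕ
    dp (var x) = 0
    dp (fun f ts) = dps ts

    dps : ∀ {n} → Vec Term n → ℕ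
    dps [] = 0
    dps (t ∷ ts) = suc (dp t) ⊔ dps ts

  data _⊏_ : Term → Term → Set where
    sub : ∀ {t u f} {ts : Vec Term (ar f)} →
          u ∈ᵥ ts → (t ≡ u ⊎ t ⊏ u) → t ⊏ fun f ts

  _⊑_ : Term → Term → Set
  t ⊑ s = t ≡ s ⊎ t ⊏ s

  Rule : Set
  Rule = Term × Term

  Rules : Set₁
  Rules = Rule → Set

  data Step (P : Rules) : Term → Term → Set where
    root : ∀ {l r} → P (l , r) → (σ : Subst) → Step P (l ⟨ σ ⟩) (r ⟨ σ ⟩)
    arg  : ∀ {f} {ts : Vec Term (ar f)} (i : Fin (ar f)) {t} →
           Step P (lookup ts i) t → Step P (fun f ts) (fun f (ts [ i ]≔ t))

  data Iter (_⟶_ : Term → Term → Set) : ℕ → Term → Term → Set where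
    done : ∀ {s} → Iter _⟶_ zero s s
    next : ∀ {n s t u} → s ⟶ t → Iter _⟶_ n t u → Iter _⟶_ (suc n) s u

  data RelStep (P Q : Rules) : Term → Term → Set where
    rel : ∀ {s s' t' t} → Star (Step Q) s s' → Step P s' t' → Star (Step Q) t' t →
          RelStep P Q s t

IsMax : (ℕ → Set) → ℕ → Set
IsMax P n = P n × (∀ m → P m → m ≤′ n)
  where open import Data.Nat using () renaming (_≤_ to _≤′_)

module TRS (S : Sig) where
  open Sig S
  open Terms S public

  -- the signature extended by marked symbols f♯ (inj₂ f) of the same arity
  S♯ : Sig
  S♯ = record { Sym = Sym ⊎ Sym ; ar = [ ar , ar ]′ }

  module T♯ = Terms S♯
  open T♯ using () renaming (Term to Term♯; Rule to Rule♯; Rules to Rules♯) public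

  mutual
    emb : Term → Term♯
    emb (var x) = T♯.var x
    emb (fun f ts) = T♯.fun (inj₁ f) (embs ts)

    embs : ∀ {n} → Vec Term n → Vec Term♯ n
    embs [] = []
    embs (t ∷ ts) = emb t ∷ embs ts

  _♯ : Term → Term♯
  var x ♯ = T♯.var x
  fun f ts ♯ = T♯.fun (inj₂ f) (embs ts)

  TRSys : Set
  TRSys = List Rule

  _⟶[_]_ : Term → TRSys → Term → Set
  s ⟶[ R ] t = Step (_∈ R) s t

  Terminating : TRSys → Set
  Terminating R = WellFounded (λ t s → s ⟶[ R ] t)

  Defined : TRSys → Sym → Set
  Defined R f = Σ Term λ l → Σ Term λ r → Σ (Vec Term (ar f)) λ ts →
                (l , r) ∈ R × l ≡ fun f ts

  HasDefinedRoot : TRSys → Term → Set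
  HasDefinedRoot R u = Σ Sym λ f → Σ (Vec Term (ar f)) λ ts →
                       u ≡ fun f ts × Defined R f

  DP : TRSys → Rules♯
  DP R (l' , u') = Σ Term λ l → Σ Term λ r → Σ Term λ u →
    (l , r) ∈ R × u ⊑ r × HasDefinedRoot R u × ¬ (u ⊏ l) ×
    l' ≡ (l ♯) × u' ≡ (u ♯)

  R⁺ : TRSys → Rules♯
  R⁺ R (l' , r') = Σ Term λ l → Σ Term λ r →
    (l , r) ∈ R × l' ≡ emb l × r' ≡ emb r

  DPrel : TRSys → Term♯ → Term♯ → Set
  DPrel R = T♯.RelStep (DP R) (R⁺ R)

  IsDh : TRSys → Term♯ → ℕ → Set
  IsDh R s = IsMax (λ n → ∃ λ u → T♯.Iter (DPrel R) n s u)

  IsF : TRSys → Term → ℕ → Set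
  IsF R s = IsMax (λ n → Σ Term λ t → t ⊑ s × IsDh R (t ♯) n)

module Submission where

-- Lemma 5.10.  Let d bound the sizes of all right-hand sides, K = 2^d.
-- A weighting of s at chain level M and depth level A (Weighted) marks each
-- position of s as a piece, whose reducts have depth ≤ A, or as a node, whose
-- marked subterm starts only DP/R chains shorter than M; its weight w ≤ |s|
-- counts the nodes.  By induction on M and on the weighting, reducts of s
-- have depth ≤ w·K^M + A (depth-claim): a derivation from a node either stays
-- below its root, or first rewrites it with l → r, and then rσ has a
-- weighting at level M - 1 of weight ≤ |r| ≤ K whose pieces are instances of
-- proper subterms of l and whose nodes are reached by a DP step.  Classical steps use the double-negation monad, which
-- is harmless because the final goal is a decidable inequality.

open import Level using (0ℓ)
open import Defs
open import Function using (_∘_; _$_)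
open import Data.Nat using (ℕ; zero; suc; _+_; _*_; _^_; _≤_; _<_; _⊔_; z≤n; s≤s; _≟_; _≤?_; NonZero)
open import Data.Nat.Properties
open import Data.Fin using (zero; suc)
import Data.Fin as Fin
open import Data.Vec using (Vec; []; _∷_; lookup; _[_]≔_; sum)
open import Data.Vec.Properties using (lookup∘update; lookup∘update′; ∷-injective)
open import Data.Vec.Relation.Unary.Any as VecAny using (here; there)
open import Data.Vec.Relation.Unary.Any.Properties using (lookup-index)
open import Data.Vec.Membership.Propositional using () renaming (_∈_ to _∈ᵥ_)
open import Data.Vec.Membership.Propositional.Properties using (∈-lookup)
open import Data.List using (List; []; _∷_; _++_; map; concat; tabulate)
open import Data.List.Extrema.Nat using (max; xs≤max)
import Data.List.Relation.Unary.All as All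
open import Data.List.Relation.Unary.Any using (here; there)
open import Data.List.Relation.Unary.Any.Properties using (tabulate⁺)
open import Data.List.Membership.Propositional using (_∈_)
open import Data.List.Membership.Propositional.Properties using (∈-++⁺ˡ; ∈-++⁺ʳ; ∈-map⁺; ∈-concat⁺)
open import Data.Product using (Σ; ∃; _×_; _,_; proj₁; proj₂)
open import Data.Sum using (inj₁; inj₂)
open import Data.Empty using (⊥; ⊥-elim)
open import Effect.Monad using (RawMonad)
open import Relation.Binary.PropositionalEquality
open import Relation.Binary.Construct.Closure.ReflexiveTransitive using (Star; ε; _◅_; _◅◅_)
open import Relation.Nullary using (¬_; Dec; yes; no)
open import Relation.Nullary.Decidable using (decidable-stable; ¬¬-excluded-middle)
open import Relation.Nullary.Negation using (¬¬-Monad)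
open import Induction.WellFounded using (Acc; acc)

open RawMonad (¬¬-Monad {a = 0ℓ}) using (pure; _>>=_)

bounded-max : (P : ℕ → Set) → ∀ {n₀} → P n₀ → ∀ B → (∀ m → P m → m ≤ B) →
              ¬ ¬ Σ ℕ (IsMax P)
bounded-max P p₀ zero bound = pure (_ , p₀ , λ m pm → ≤-trans (bound m pm) z≤n)
bounded-max P p₀ (suc B) bound = do
  no ¬top ← ¬¬-excluded-middle {A = P (suc B)}
    where yes top → pure (suc B , top , bound)
  bounded-max P p₀ B λ m pm →
    m<1+n⇒m≤n (≤∧≢⇒< (bound m pm) λ { refl → ¬top pm })

lookup≤sum : ∀ {n} (ws : Vec ℕ n) i → lookup ws i ≤ sum ws
lookup≤sum (w ∷ ws) zero = m≤m+n w (sum ws)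
lookup≤sum (w ∷ ws) (suc i) = ≤-trans (lookup≤sum ws i) (m≤n+m (sum ws) w)

n<2^n : ∀ n → n < 2 ^ n
n<2^n zero = s≤s z≤n
n<2^n (suc n) = +-mono-≤ (m^n>0 2 n) (≤-trans (n<2^n n) (m≤m+n (2 ^ n) 0))

module TermFacts (S : Sig) where
  open Sig S
  open Terms S

  ⊏-trans : ∀ {a b c} → a ⊏ b → b ⊏ c → a ⊏ c
  ⊏-trans ab (sub m (inj₁ refl)) = sub m (inj₂ ab)
  ⊏-trans ab (sub m (inj₂ bu)) = sub m (inj₂ (⊏-trans ab bu))

  ⊑-⊏-trans : ∀ {a b c} → a ⊑ b → b ⊏ c → a ⊏ c
  ⊑-⊏-trans (inj₁ refl) bc = bc
  ⊑-⊏-trans (inj₂ ab) bc = ⊏-trans ab bc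

  ⊑-trans : ∀ {a b c} → a ⊑ b → b ⊑ c → a ⊑ c
  ⊑-trans ab (inj₁ refl) = ab
  ⊑-trans ab (inj₂ bc) = inj₂ (⊑-⊏-trans ab bc)

  arg-⊑ : ∀ {f u r} {ts : Vec Term (ar f)} → u ∈ᵥ ts → fun f ts ⊑ r → u ⊑ r
  arg-⊑ m = ⊑-trans (inj₂ (sub m (inj₁ refl)))

  fun-inv : ∀ {f g} {ts : Vec Term (ar f)} {us : Vec Term (ar g)} → fun f ts ≡ fun g us →
            Σ (f ≡ g) λ e → subst (λ h → Vec Term (ar h)) e ts ≡ us
  fun-inv refl = refl , refl

  ∈-subs : ∀ {n u} {ts : Vec Term n} σ → u ∈ᵥ ts → (u ⟨ σ ⟩) ∈ᵥ subs ts σ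
  ∈-subs σ (here refl) = here refl
  ∈-subs σ (there m) = there (∈-subs σ m)

  ⊏-subst : ∀ {a b} σ → a ⊏ b → (a ⟨ σ ⟩) ⊏ (b ⟨ σ ⟩)
  ⊏-subst σ (sub m (inj₁ refl)) = sub (∈-subs σ m) (inj₁ refl)
  ⊏-subst σ (sub m (inj₂ p)) = sub (∈-subs σ m) (inj₂ (⊏-subst σ p))

  ⊑-subst : ∀ {a b} σ → a ⊑ b → (a ⟨ σ ⟩) ⊑ (b ⟨ σ ⟩)
  ⊑-subst σ (inj₁ refl) = inj₁ refl
  ⊑-subst σ (inj₂ p) = inj₂ (⊏-subst σ p)

  mutual
    agree : ∀ t {σ τ : Subst} → (∀ {x} → var x ⊑ t → σ x ≡ τ x) → t ⟨ σ ⟩ ≡ t ⟨ τ ⟩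
    agree (var x) h = h (inj₁ refl)
    agree (fun f ts) h = cong (fun f) (agrees ts λ m p → h (inj₂ (sub m p)))

    agrees : ∀ {n} (ts : Vec Term n) {σ τ : Subst} →
             (∀ {x u} → u ∈ᵥ ts → var x ⊑ u → σ x ≡ τ x) → subs ts σ ≡ subs ts τ
    agrees [] h = refl
    agrees (t ∷ ts) h = cong₂ _∷_ (agree t (h (here refl))) (agrees ts λ m → h (there m))

  mutual
    match-agree : ∀ t {σ τ x} → t ⟨ σ ⟩ ≡ t ⟨ τ ⟩ → var x ⊑ t → σ x ≡ τ x
    match-agree (var y) e (inj₁ refl) = e
    match-agree (var y) e (inj₂ ())
    match-agree (fun f ts) e (inj₁ ())
    match-agree (fun f ts) e (inj₂ (sub m p)) with fun-inv e
    ... | refl , e′ = matches-agree ts e′ m p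

    matches-agree : ∀ {n} (ts : Vec Term n) {σ τ x u} → subs ts σ ≡ subs ts τ →
                    u ∈ᵥ ts → var x ⊑ u → σ x ≡ τ x
    matches-agree (t ∷ ts) e (here refl) = match-agree t (proj₁ (∷-injective e))
    matches-agree (t ∷ ts) e (there m) = matches-agree ts (proj₂ (∷-injective e)) m

  mutual
    subst-id : ∀ t → t ⟨ var ⟩ ≡ t
    subst-id (var x) = refl
    subst-id (fun f ts) = cong (fun f) (subs-id ts)

    subs-id : ∀ {n} (ts : Vec Term n) → subs ts var ≡ ts
    subs-id [] = refl
    subs-id (t ∷ ts) = cong₂ _∷_ (subst-id t) (subs-id ts)

  dp-∈ : ∀ {n u} {ts : Vec Term n} → u ∈ᵥ ts → suc (dp u) ≤ dps ts
  dp-∈ {ts = t ∷ ts} (here refl) = m≤m⊔n (suc (dp t)) (dps ts)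
  dp-∈ {ts = t ∷ ts} (there m) = ≤-trans (dp-∈ m) (m≤n⊔m (suc (dp t)) (dps ts))

  dp-⊏ : ∀ {a b} → a ⊏ b → suc (dp a) ≤ dp b
  dp-⊏ (sub m (inj₁ refl)) = dp-∈ m
  dp-⊏ (sub m (inj₂ p)) = ≤-trans (m≤n⇒m≤1+n (dp-⊏ p)) (dp-∈ m)

  dp-⊑ : ∀ {a b} → a ⊑ b → dp a ≤ dp b
  dp-⊑ (inj₁ refl) = ≤-refl
  dp-⊑ (inj₂ p) = ≤-trans (n≤1+n _) (dp-⊏ p)

  dps-lub : ∀ {n} (ts : Vec Term n) {Y} → (∀ i → suc (dp (lookup ts i)) ≤ Y) → dps ts ≤ Y
  dps-lub [] h = z≤n
  dps-lub (t ∷ ts) h = ⊔-lub (h zero) (dps-lub ts (h ∘ suc))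

  module _ {_⟶_ : Term → Term → Set} where
    iter-++ : ∀ {m n a b c} → Iter _⟶_ m a b → Iter _⟶_ n b c → Iter _⟶_ (m + n) a c
    iter-++ done r = r
    iter-++ (next s r) r′ = next s (iter-++ r r′)

    star⇒iter : ∀ {a b} → Star _⟶_ a b → ∃ λ n → Iter _⟶_ n a b
    star⇒iter ε = 0 , done
    star⇒iter (s ◅ r) = let n , it = star⇒iter r in suc n , next s it

  module _ {P : Rules} where
    step-⊑ : ∀ {a b a′} → a ⊑ b → Step P a a′ → ∃ λ b′ → Step P b b′ × a′ ⊑ b′
    step-⊑ (inj₁ refl) st = _ , st , inj₁ refl
    step-⊑ {b = fun f ts} (inj₂ (sub m p)) st
      with VecAny.index m | lookup-index m | step-⊑ p st
    ... | i | refl | u′ , st′ , q = fun f (ts [ i ]≔ u′) , arg i st′ , inj₂ (sub u′∈ q)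
      where
      u′∈ : u′ ∈ᵥ ts [ i ]≔ u′
      u′∈ = subst (_∈ᵥ ts [ i ]≔ u′) (lookup∘update i ts u′) (∈-lookup i (ts [ i ]≔ u′))

    star-⊑ : ∀ {a b a′} → a ⊑ b → Star (Step P) a a′ → ∃ λ b′ → Star (Step P) b b′ × a′ ⊑ b′
    star-⊑ p ε = _ , ε , p
    star-⊑ p (st ◅ r) =
      let _ , st′ , q = step-⊑ p st
          b′ , r′ , q′ = star-⊑ q r
      in b′ , st′ ◅ r′ , q′

    iter-⊑ : ∀ {n a b a′} → a ⊑ b → Iter (Step P) n a a′ → ∃ λ b′ → Iter (Step P) n b b′ × a′ ⊑ b′
    iter-⊑ p done = _ , done , p
    iter-⊑ p (next st r) =
      let _ , st′ , q = step-⊑ p st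
          b′ , r′ , q′ = iter-⊑ q r
      in b′ , next st′ r′ , q′

-- Consequences of termination of R.
module TerminationFacts (S : Sig) (R : List (Terms.Rule S)) (wf : TRS.Terminating S R) where
  open Sig S
  open TRS S
  open TermFacts S

  infix 4 _⟶*_
  _⟶*_ : Term → Term → Set
  a ⟶* b = Star (_⟶[ R ]_) a b

  -- A rule var x → r rewrites every term, so no term would terminate.
  lhs-not-var : ∀ {x r} → ¬ (var x , r) ∈ R
  lhs-not-var {x} mem = diverges (var 0) (wf (var 0))
    where
    diverges : ∀ a → Acc (λ t s → s ⟶[ R ] t) a → ⊥
    diverges a (acc rs) = diverges _ (rs (root {l = var x} mem (λ _ → a)))

  -- A term that reappears inside one of its reducts starts an infinite derivation.
  no-self-embedding : ∀ {s t} → s ⟶[ R ] t → s ⊑ t → ⊥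
  no-self-embedding {s} st s⊑t = diverges s (wf s) (inj₁ refl)
    where
    diverges : ∀ u → Acc (λ t s → s ⟶[ R ] t) u → s ⊑ u → ⊥
    diverges u (acc rs) s⊑u =
      let u′ , st′ , t⊑u′ = step-⊑ s⊑u st in diverges u′ (rs st′) (⊑-trans s⊑t t⊑u′)

  mutual
    occurs? : ∀ x t → Dec (var x ⊑ t)
    occurs? x (var y) with x ≟ y
    ... | yes refl = yes (inj₁ refl)
    ... | no x≢y = no λ { (inj₁ refl) → x≢y refl ; (inj₂ ()) }
    occurs? x (fun f ts) with occurs-in? x ts
    ... | yes (u , m , p) = yes (inj₂ (sub m p))
    ... | no ¬occ = no λ { (inj₁ ()) ; (inj₂ (sub m p)) → ¬occ (_ , m , p) }

    occurs-in? : ∀ {n} x (ts : Vec Term n) → Dec (∃ λ u → u ∈ᵥ ts × var x ⊑ u)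
    occurs-in? x [] = no λ { (_ , () , _) }
    occurs-in? x (t ∷ ts) with occurs? x t | occurs-in? x ts
    ... | yes p | _ = yes (t , here refl , p)
    ... | no _ | yes (u , m , p) = yes (u , there m , p)
    ... | no ¬p | no ¬ps = no λ { (_ , here refl , p) → ¬p p ; (u , there m , p) → ¬ps (u , m , p) }

  -- Variable condition: a variable x of r not occurring in l could be
  -- instantiated by l itself, embedding l into its own reduct.
  rhs-var⊑lhs : ∀ {l r x} → (l , r) ∈ R → var x ⊑ r → var x ⊑ l
  rhs-var⊑lhs {l} {r} {x} mem p with occurs? x l
  ... | yes q = q
  ... | no ¬q = ⊥-elim (no-self-embedding l⟶rσ l⊑rσ)
    where
    σ : Subst
    σ y with y ≟ x
    ... | yes _ = l
    ... | no _ = var y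

    σ-fixes-l : ∀ {y} → var y ⊑ l → σ y ≡ var y
    σ-fixes-l {y} q with y ≟ x
    ... | yes refl = ⊥-elim (¬q q)
    ... | no _ = refl

    σx≡l : σ x ≡ l
    σx≡l with x ≟ x
    ... | yes _ = refl
    ... | no x≢x = ⊥-elim (x≢x refl)

    l⟶rσ : l ⟶[ R ] (r ⟨ σ ⟩)
    l⟶rσ = subst (_⟶[ R ] (r ⟨ σ ⟩)) (trans (agree l σ-fixes-l) (subst-id l)) (root mem σ)

    l⊑rσ : l ⊑ (r ⟨ σ ⟩)
    l⊑rσ = subst (_⊑ (r ⟨ σ ⟩)) σx≡l (⊑-subst σ p)

  -- Since left-hand sides are not variables, their variables are proper subterms.
  rhs-var⊏lhs : ∀ {l r x} → (l , r) ∈ R → var x ⊑ r → var x ⊏ l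
  rhs-var⊏lhs mem p with rhs-var⊑lhs mem p
  ... | inj₁ refl = ⊥-elim (lhs-not-var mem)
  ... | inj₂ q = q

  var-normal : ∀ {s y x} → s ⟶[ R ] y → s ≡ var x → ⊥
  var-normal (root {l = var z} mem σ) _ = lhs-not-var mem
  var-normal (root {l = fun f ls} mem σ) ()
  var-normal (arg i st) ()

  var-reducts : ∀ {x u} → var x ⟶* u → u ≡ var x
  var-reducts ε = refl
  var-reducts (st ◅ _) = ⊥-elim (var-normal st refl)

  FinitelyBranching : Term → Set
  FinitelyBranching s = ∃ λ (L : List Term) → ∀ {y} → s ⟶[ R ] y → y ∈ L

  -- Each rule contributes at most one root reduct of s, since by the
  -- variable condition rσ is determined by lσ.
  root-reducts : (Rs : List Rule) → (∀ {ρ} → ρ ∈ Rs → ρ ∈ R) → ∀ s →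
    ¬ ¬ ∃ λ (L : List Term) → ∀ {l r σ} → (l , r) ∈ Rs → l ⟨ σ ⟩ ≡ s → r ⟨ σ ⟩ ∈ L
  root-reducts [] _ s = pure ([] , λ ())
  root-reducts ((l , r) ∷ Rs) Rs⊆R s = do
    L , covers ← root-reducts Rs (λ m → Rs⊆R (there m)) s
    yes (σ₀ , lσ₀≡s) ← ¬¬-excluded-middle {A = ∃ λ σ → l ⟨ σ ⟩ ≡ s}
      where no ¬match → pure (L , λ { (here refl) lσ≡s → ⊥-elim (¬match (_ , lσ≡s))
                                     ; (there m) lσ≡s → covers m lσ≡s })
    let determined : ∀ {σ} → l ⟨ σ ⟩ ≡ s → r ⟨ σ ⟩ ≡ r ⟨ σ₀ ⟩
        determined lσ≡s = agree r λ p →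
          match-agree l (trans lσ≡s (sym lσ₀≡s)) (rhs-var⊑lhs (Rs⊆R (here refl)) p)
    pure (r ⟨ σ₀ ⟩ ∷ L , λ { (here refl) lσ≡s → here (determined lσ≡s)
                          ; (there m) lσ≡s → there (covers m lσ≡s) })

  successor-∈ : ∀ {s y g ss} → s ⟶[ R ] y → s ≡ fun g ss → ∀ {L₁ L₂} →
    (∀ {l r σ} → (l , r) ∈ R → l ⟨ σ ⟩ ≡ fun g ss → r ⟨ σ ⟩ ∈ L₁) →
    (∀ i {t} → lookup ss i ⟶[ R ] t → fun g (ss [ i ]≔ t) ∈ L₂) → y ∈ L₁ ++ L₂
  successor-∈ (root mem σ) e root∈ _ = ∈-++⁺ˡ (root∈ mem e)
  successor-∈ (arg i st) refl {L₁} _ arg∈ = ∈-++⁺ʳ L₁ (arg∈ i st)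

  mutual
    finitely-branching : ∀ s → ¬ ¬ FinitelyBranching s
    finitely-branching (var x) = pure ([] , λ {_} st → ⊥-elim (var-normal st refl))
    finitely-branching (fun g ss) = do
      args ← finitely-branching-args ss
      L , covers ← root-reducts R (λ m → m) (fun g ss)
      let below i = map (λ t → fun g (ss [ i ]≔ t)) (proj₁ (args i))
      pure (L ++ concat (tabulate below) , λ {_} st → successor-∈ st refl covers λ i st′ →
              ∈-concat⁺ (tabulate⁺ i (∈-map⁺ (λ t → fun g (ss [ i ]≔ t)) (proj₂ (args i) st′))))

    finitely-branching-args : ∀ {n} (ts : Vec Term n) → ¬ ¬ (∀ i → FinitelyBranching (lookup ts i))
    finitely-branching-args [] = pure λ ()
    finitely-branching-args (t ∷ ts) = do
      fb ← finitely-branching t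
      fbs ← finitely-branching-args ts
      pure λ { zero → fb ; (suc i) → fbs i }

  HeightBound : Term → ℕ → Set
  HeightBound s B = ∀ {m z} → Iter (_⟶[ R ]_) m s z → m ≤ B

  -- König's lemma: a terminating, finitely branching term has a bound on
  -- the lengths of its derivations.
  bounded-height : ∀ s → ¬ ¬ ∃ (HeightBound s)
  bounded-height s = bounded s (wf s)
    where
    bounded : ∀ s → Acc (λ t s → s ⟶[ R ] t) s → ¬ ¬ ∃ (HeightBound s)
    bounded s (acc rs) = do
        L , covers ← finitely-branching s
        B , succ-bounded ← successors-bounded L
        pure (suc B , λ { done → z≤n ; (next st it) → s≤s (succ-bounded (covers st) st it) })
      where
      successors-bounded : (L : List Term) →
        ¬ ¬ ∃ λ B → ∀ {y} → y ∈ L → s ⟶[ R ] y → HeightBound y B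
      successors-bounded [] = pure (0 , λ ())
      successors-bounded (y ∷ L) = do
        B , L-bounded ← successors-bounded L
        yes st ← ¬¬-excluded-middle {A = s ⟶[ R ] y}
          where no ¬st → pure (B , λ { (here refl) st → ⊥-elim (¬st st)
                                      ; (there m) → L-bounded m })
        By , y-bounded ← bounded y (rs st)
        pure (By ⊔ B , λ { (here refl) _ it → ≤-trans (y-bounded it) (m≤m⊔n By B)
                         ; (there m) st′ it → ≤-trans (L-bounded m st′ it) (m≤n⊔m By B) })

-- Marked terms, and the projection of DP/R chains to R-derivations.
module MarkedTerms (S : Sig) (R : List (Terms.Rule S)) (wf : TRS.Terminating S R) where
  open Sig S
  open TRS S
  open TermFacts S
  open TerminationFacts S R wf
  private module TF♯ = TermFacts S♯

  mutual
    strip : Term♯ → Term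
    strip (T♯.var x) = var x
    strip (T♯.fun (inj₁ f) ts) = fun f (strips ts)
    strip (T♯.fun (inj₂ f) ts) = fun f (strips ts)

    strips : ∀ {n} → Vec Term♯ n → Vec Term n
    strips [] = []
    strips (t ∷ ts) = strip t ∷ strips ts

  mutual
    strip-emb : ∀ a → strip (emb a) ≡ a
    strip-emb (var x) = refl
    strip-emb (fun f ts) = cong (fun f) (strips-embs ts)

    strips-embs : ∀ {n} (ts : Vec Term n) → strips (embs ts) ≡ ts
    strips-embs [] = refl
    strips-embs (t ∷ ts) = cong₂ _∷_ (strip-emb t) (strips-embs ts)

  lookup-embs : ∀ {n} (as : Vec Term n) i → lookup (embs as) i ≡ emb (lookup as i)
  lookup-embs (a ∷ as) zero = refl
  lookup-embs (a ∷ as) (suc i) = lookup-embs as i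

  embs-update : ∀ {n} (as : Vec Term n) i b → embs (as [ i ]≔ b) ≡ embs as [ i ]≔ emb b
  embs-update (a ∷ as) zero b = refl
  embs-update (a ∷ as) (suc i) b = cong (emb a ∷_) (embs-update as i b)

  mutual
    emb-subst : ∀ r {σ : T♯.Subst} {τ : Subst} → (∀ {x} → var x ⊑ r → σ x ≡ emb (τ x)) →
                T♯._⟨_⟩ (emb r) σ ≡ emb (r ⟨ τ ⟩)
    emb-subst (var x) h = h (inj₁ refl)
    emb-subst (fun f ts) h = cong (T♯.fun (inj₁ f)) (embs-subst ts λ m p → h (inj₂ (sub m p)))

    embs-subst : ∀ {n} (ts : Vec Term n) {σ : T♯.Subst} {τ : Subst} →
                 (∀ {x u} → u ∈ᵥ ts → var x ⊑ u → σ x ≡ emb (τ x)) →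
                 T♯.subs (embs ts) σ ≡ embs (subs ts τ)
    embs-subst [] h = refl
    embs-subst (t ∷ ts) h = cong₂ _∷_ (emb-subst t (h (here refl))) (embs-subst ts λ m → h (there m))

  mutual
    emb-match : ∀ l {σ : T♯.Subst} a → T♯._⟨_⟩ (emb l) σ ≡ emb a →
                l ⟨ strip ∘ σ ⟩ ≡ a × (∀ {x} → var x ⊑ l → σ x ≡ emb (strip (σ x)))
    emb-match (var x) a e = σx≡a , λ { (inj₁ refl) → trans e (cong emb (sym σx≡a)) ; (inj₂ ()) }
      where σx≡a = trans (cong strip e) (strip-emb a)
    emb-match (fun f ls) (var x) ()
    emb-match (fun f ls) (fun g as) e with TF♯.fun-inv e
    ... | refl , e′ with embs-match ls as e′
    ... | ls≡as , σ-emb = cong (fun f) ls≡as , λ { (inj₁ ()) ; (inj₂ (sub m p)) → σ-emb m p }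

    embs-match : ∀ {n} (ls as : Vec Term n) {σ : T♯.Subst} → T♯.subs (embs ls) σ ≡ embs as →
                 subs ls (strip ∘ σ) ≡ as × (∀ {x u} → u ∈ᵥ ls → var x ⊑ u → σ x ≡ emb (strip (σ x)))
    embs-match [] [] e = refl , λ ()
    embs-match (l ∷ ls) (a ∷ as) e with ∷-injective e
    ... | e₁ , e₂ with emb-match l a e₁ | embs-match ls as e₂
    ... | l≡a , σ-emb₁ | ls≡as , σ-emb₂ =
      cong₂ _∷_ l≡a ls≡as , λ { (here refl) → σ-emb₁ ; (there m) → σ-emb₂ m }

  embs-arg-step : ∀ c {ts : Vec Term (Sig.ar S♯ c)} i {t} →
                  T♯.Step (R⁺ R) (emb (lookup ts i)) (emb t) →
                  T♯.Step (R⁺ R) (T♯.fun c (embs ts)) (T♯.fun c (embs (ts [ i ]≔ t)))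
  embs-arg-step c {ts} i {t} st rewrite embs-update ts i t =
    T♯.arg i (subst (λ a → T♯.Step (R⁺ R) a (emb t)) (sym (lookup-embs ts i)) st)

  emb-step : ∀ {a b} → a ⟶[ R ] b → T♯.Step (R⁺ R) (emb a) (emb b)
  emb-step (root {l} {r} mem σ) =
    subst₂ (T♯.Step (R⁺ R)) (emb-subst l λ _ → refl) (emb-subst r λ _ → refl)
      (T♯.root (l , r , mem , refl , refl) (emb ∘ σ))
  emb-step (arg {f} i st) = embs-arg-step (inj₁ f) i (emb-step st)

  ♯-arg-step : ∀ {g} {ss : Vec Term (ar g)} i {t} → lookup ss i ⟶[ R ] t →
               T♯.Step (R⁺ R) (fun g ss ♯) (fun g (ss [ i ]≔ t) ♯)
  ♯-arg-step {g} i st = embs-arg-step (inj₂ g) i (emb-step st)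

  dp-step : ∀ {l r u σ} → (l , r) ∈ R → u ⊑ r → HasDefinedRoot R u → ¬ u ⊏ l →
            T♯.Step (DP R) ((l ⟨ σ ⟩) ♯) ((u ⟨ σ ⟩) ♯)
  dp-step {var x} mem _ _ _ = ⊥-elim (lhs-not-var mem)
  dp-step {fun f ls} {r} {u} {σ} mem u⊑r defined@(h , us , refl , _) ¬u⊏l =
    subst₂ (T♯.Step (DP R)) (♯-subst ls) (♯-subst us)
      (T♯.root (fun f ls , r , u , mem , u⊑r , defined , ¬u⊏l , refl , refl) (emb ∘ σ))
    where
    ♯-subst : ∀ {g} (ts : Vec Term (ar g)) → T♯._⟨_⟩ (fun g ts ♯) (emb ∘ σ) ≡ (fun g ts ⟨ σ ⟩) ♯
    ♯-subst ts = cong (T♯.fun _) (embs-subst ts λ _ _ → refl)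

  step-from-emb : ∀ {s y} → T♯.Step (R⁺ R) s y → ∀ a → s ≡ emb a →
                  ∃ λ a′ → y ≡ emb a′ × a ⟶[ R ] a′
  step-from-emb (T♯.root (l , r , mem , refl , refl) σ) a e with emb-match l a e
  ... | lτ≡a , σ-emb = r ⟨ τ ⟩ , emb-subst r (λ p → σ-emb (rhs-var⊑lhs mem p)) ,
                       subst (_⟶[ R ] (r ⟨ τ ⟩)) lτ≡a (root mem τ)
    where τ = strip ∘ σ
  step-from-emb (T♯.arg i st) (var x) ()
  step-from-emb (T♯.arg i st) (fun f as) refl with step-from-emb st (lookup as i) (lookup-embs as i)
  ... | a′ , refl , st′ = fun f (as [ i ]≔ a′) , cong (T♯.fun (inj₁ f)) (sym (embs-update as i a′)) , arg i st′

  step-from-♯ : ∀ {s y} → T♯.Step (R⁺ R) s y → ∀ w → s ≡ w ♯ →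
                ∃ λ w′ → y ≡ w′ ♯ × w ⟶[ R ] w′
  step-from-♯ (T♯.root (var x , r , mem , refl , refl) σ) w e = ⊥-elim (lhs-not-var mem)
  step-from-♯ (T♯.root (fun f ls , r , mem , refl , refl) σ) (var x) ()
  step-from-♯ (T♯.root (fun f ls , r , mem , refl , refl) σ) (fun g ws) ()
  step-from-♯ (T♯.arg i st) (var x) ()
  step-from-♯ (T♯.arg i st) (fun f as) refl with step-from-emb st (lookup as i) (lookup-embs as i)
  ... | a′ , refl , st′ = fun f (as [ i ]≔ a′) , cong (T♯.fun (inj₂ f)) (sym (embs-update as i a′)) , arg i st′

  star-from-♯ : ∀ w {y} → Star (T♯.Step (R⁺ R)) (w ♯) y → ∃ λ w′ → y ≡ w′ ♯ × w ⟶* w′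
  star-from-♯ w ε = w , refl , ε
  star-from-♯ w (st ◅ r) with step-from-♯ st w refl
  ... | w₁ , refl , st₁ = let w′ , e , r′ = star-from-♯ w₁ r in w′ , e , st₁ ◅ r′

  -- DP-steps need a marked symbol, which embedded terms lack.
  no-dp-step-from-emb : ∀ {s y} → T♯.Step (DP R) s y → ∀ a → s ≡ emb a → ⊥
  no-dp-step-from-emb (T♯.root (var x , _ , _ , mem , _) σ) _ _ = lhs-not-var mem
  no-dp-step-from-emb (T♯.root (fun f ls , _ , _ , _ , _ , _ , _ , refl , refl) σ) (var x) ()
  no-dp-step-from-emb (T♯.root (fun f ls , _ , _ , _ , _ , _ , _ , refl , refl) σ) (fun g as) ()
  no-dp-step-from-emb (T♯.arg i st) (var x) ()
  no-dp-step-from-emb (T♯.arg i st) (fun f as) refl = no-dp-step-from-emb st (lookup as i) (lookup-embs as i)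

  dp-step-from-♯ : ∀ {s y} → T♯.Step (DP R) s y → ∀ w → s ≡ w ♯ →
                   ∃ λ w′ → y ≡ w′ ♯ × ∃ λ z → w ⟶[ R ] z × w′ ⊑ z
  dp-step-from-♯ (T♯.root (var x , _ , _ , mem , _) σ) w e = ⊥-elim (lhs-not-var mem)
  dp-step-from-♯ (T♯.root (fun f ls , _ , _ , _ , _ , _ , _ , refl , refl) σ) (var x) ()
  dp-step-from-♯ (T♯.root (fun f ls , r , .(fun h us) , mem , u⊑r , (h , us , refl , _) , _ , refl , refl) σ)
                 (fun g ws) e with TF♯.fun-inv e
  ... | refl , e′ with embs-match ls ws e′
  ... | lτ≡w , σ-emb =
    fun h us ⟨ τ ⟩ ,
    cong (T♯.fun (inj₂ h)) (embs-subst us λ m p → σ-emb-l (rhs-var⊑lhs mem (⊑-trans (inj₂ (sub m p)) u⊑r))) ,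
    r ⟨ τ ⟩ , subst (_⟶[ R ] (r ⟨ τ ⟩)) (cong (fun f) lτ≡w) (root mem τ) , ⊑-subst τ u⊑r
    where
    τ = strip ∘ σ
    σ-emb-l : ∀ {x} → var x ⊑ fun f ls → σ x ≡ emb (strip (σ x))
    σ-emb-l (inj₁ ())
    σ-emb-l (inj₂ (sub m p)) = σ-emb m p
  dp-step-from-♯ (T♯.arg i st) (var x) ()
  dp-step-from-♯ (T♯.arg i st) (fun f as) refl = ⊥-elim (no-dp-step-from-emb st (lookup as i) (lookup-embs as i))

  rel-step-from-♯ : ∀ w {y} → DPrel R (w ♯) y →
    ∃ λ w′ → y ≡ w′ ♯ × ∃ λ k → ∃ λ z → Iter (_⟶[ R ]_) (suc k) w z × w′ ⊑ z
  rel-step-from-♯ w (T♯.rel before dp after) with star-from-♯ w before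
  ... | w₁ , refl , red₁ with dp-step-from-♯ dp w₁ refl
  ... | w₂ , refl , z , st , w₂⊑z with star-from-♯ w₂ after
  ... | w₃ , refl , red₃ =
    let z′ , red-z , w₃⊑z′ = star-⊑ w₂⊑z red₃
        j , it₁ = star⇒iter red₁
        k , it₂ = star⇒iter red-z
    in w₃ , refl , j + k , z′ ,
       subst (λ m → Iter (_⟶[ R ]_) m w z′) (+-suc j k) (iter-++ it₁ (next st it₂)) , w₃⊑z′

  chain-to-derivation : ∀ w {n x} → T♯.Iter (DPrel R) n (w ♯) x →
                        ∃ λ m → n ≤ m × ∃ λ z → Iter (_⟶[ R ]_) m w z
  chain-to-derivation w T♯.done = 0 , z≤n , w , done
  chain-to-derivation w (T♯.next step rest) with rel-step-from-♯ w step
  ... | w′ , refl , k , z , it , w′⊑z with chain-to-derivation w′ rest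
  ... | m , n≤m , _ , it′ =
    let z′ , it″ , _ = iter-⊑ w′⊑z it′
    in suc k + m , s≤s (≤-trans n≤m (m≤n+m m k)) , z′ , iter-++ it it″

  -- By König's lemma, DP/R chains from w♯ have bounded length.
  bounded-chains : ∀ w → ¬ ¬ ∃ λ B → ∀ {n x} → T♯.Iter (DPrel R) n (w ♯) x → n ≤ B
  bounded-chains w = do
    B , bounded ← bounded-height w
    pure (B , λ {_} {_} ch → let m , n≤m , _ , it = chain-to-derivation w ch in ≤-trans n≤m (bounded it))

  -- For a subterm v of t, every DP/R chain from v♯ is at most f(t) long:
  -- dh(v♯) exists because chains are bounded, and f(t) dominates it.
  chains≤f : ∀ {t N} → IsF R t N → ∀ {v} → v ⊑ t → ∀ {n x} → T♯.Iter (DPrel R) n (v ♯) x → n ≤ N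
  chains≤f {N = N} (_ , f-max) {v} v⊑t {n} ch = decidable-stable (n ≤? N) $ do
    B , bounded ← bounded-chains v
    h , dh , dh-max ← bounded-max (λ n → ∃ λ x → T♯.Iter (DPrel R) n (v ♯) x) (_ , T♯.done) B
                                  (λ _ (_ , ch′) → bounded ch′)
    pure (≤-trans (dh-max n (_ , ch)) (f-max h (v , v⊑t , dh , dh-max)))

-- The weighted depth bound, for any K ≥ 1 bounding the right-hand side sizes.
module DepthBound (S : Sig) (R : List (Terms.Rule S)) (wf : TRS.Terminating S R)
                  (K : ℕ) {{_ : NonZero K}} (rhs≤K : ∀ {l r} → (l , r) ∈ R → Terms.size S r ≤ K) where
  open Sig S
  open TRS S
  open TermFacts S
  open TerminationFacts S R wf
  open MarkedTerms S R wf

  DepthBounded : ℕ → Term → Set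
  DepthBounded A s = ∀ {u} → s ⟶* u → dp u ≤ A

  ChainsBelow : ℕ → Term → Set
  ChainsBelow M s = ∀ {n x} → T♯.Iter (DPrel R) n (s ♯) x → n < M

  data Weighted (M A : ℕ) : Term → ℕ → Set where
    piece : ∀ {s} → DepthBounded A s → Weighted M A s 0
    node  : ∀ {g ss} (ws : Vec ℕ (ar g)) → (Defined R g → ChainsBelow M (fun g ss)) →
            (∀ i → Weighted M A (lookup ss i) (lookup ws i)) → Weighted M A (fun g ss) (suc (sum ws))

  module Weighting (M A : ℕ) (P : Term → Set) (r : Term) (σ : Subst)
    (piece-ok : ∀ {v} → v ⊑ r → P v → DepthBounded A (v ⟨ σ ⟩))
    (var-P    : ∀ {x} → var x ⊑ r → P (var x))
    (node-ok  : ∀ {f vs} → fun f vs ⊑ r → ¬ P (fun f vs) → Defined R f → ChainsBelow M (fun f vs ⟨ σ ⟩)) where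
    mutual
      weighting : ∀ v → v ⊑ r → ¬ ¬ ∃ λ w → w ≤ size v × Weighted M A (v ⟨ σ ⟩) w
      weighting (var x) p = pure (0 , z≤n , piece (piece-ok p (var-P p)))
      weighting (fun f vs) p = do
        no ¬Pv ← ¬¬-excluded-middle {A = P (fun f vs)}
          where yes Pv → pure (0 , z≤n , piece (piece-ok p Pv))
        ws , ws≤ , args ← weightings vs λ m → arg-⊑ m p
        pure (suc (sum ws) , s≤s ws≤ , node ws (node-ok p ¬Pv) args)

      weightings : ∀ {n} (vs : Vec Term n) → (∀ {u} → u ∈ᵥ vs → u ⊑ r) →
        ¬ ¬ ∃ λ (ws : Vec ℕ n) → sum ws ≤ sizes vs × ∀ i → Weighted M A (lookup (subs vs σ) i) (lookup ws i)
      weightings [] _ = pure ([] , z≤n , λ ())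
      weightings (v ∷ vs) ⊑r = do
        w , w≤ , weighted ← weighting v (⊑r (here refl))
        ws , ws≤ , args ← weightings vs λ m → ⊑r (there m)
        pure (w ∷ ws , +-mono-≤ w≤ ws≤ , λ { zero → weighted ; (suc i) → args i })

  ArgStep : ∀ {n} → Vec Term n → Vec Term n → Set
  ArgStep ss ss′ = ∃ λ i → ∃ λ t → lookup ss i ⟶[ R ] t × ss′ ≡ ss [ i ]≔ t

  data RootView (g : Sym) (ss : Vec Term (ar g)) (u : Term) : Set where
    below-root : ∀ {us} → u ≡ fun g us → Star ArgStep ss us → RootView g ss u
    via-root   : ∀ {ls r σ} → Star ArgStep ss (subs ls σ) → (fun g ls , r) ∈ R →
                 r ⟨ σ ⟩ ⟶* u → RootView g ss u

  root-view : ∀ {s u g ss} → s ⟶* u → s ≡ fun g ss → RootView g ss u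
  root-view ε refl = below-root refl ε
  root-view (root {l = var x} mem σ ◅ _) _ = ⊥-elim (lhs-not-var mem)
  root-view (root {l = fun f ls} mem σ ◅ red) e with fun-inv e
  ... | refl , refl = via-root ε mem red
  root-view (arg i st ◅ red) refl with root-view red refl
  ... | below-root e args = below-root e ((i , _ , st , refl) ◅ args)
  ... | via-root args mem red′ = via-root ((i , _ , st , refl) ◅ args) mem red′

  args-reduce : ∀ {n} {ss ss′ : Vec Term n} → Star ArgStep ss ss′ → ∀ i → lookup ss i ⟶* lookup ss′ i
  args-reduce ε i = ε
  args-reduce {ss = ss} ((j , t , st , refl) ◅ args) i with i Fin.≟ j
  ... | yes refl = st ◅ subst (_⟶* _) (lookup∘update i ss t) (args-reduce args i)
  ... | no i≢j = subst (_⟶* _) (lookup∘update′ i≢j ss t) (args-reduce args i)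

  ♯-args-reduce : ∀ {g} {ss ss′ : Vec Term (ar g)} → Star ArgStep ss ss′ →
                  Star (T♯.Step (R⁺ R)) (fun g ss ♯) (fun g ss′ ♯)
  ♯-args-reduce ε = ε
  ♯-args-reduce {g} ((i , t , st , refl) ◅ args) = ♯-arg-step {g} i st ◅ ♯-args-reduce args

  -- Below the root, a node costs K^M on top of its heaviest argument.
  below-root-arith : ∀ {a s X A} → a ≤ s → 1 ≤ X → suc (a * X + A) ≤ suc s * X + A
  below-root-arith {X = X} {A} a≤s 1≤X = +-monoˡ-≤ A (+-mono-≤ 1≤X (*-monoˡ-≤ X a≤s))

  -- At the root, the rhs weighting (weight ≤ K, level M) costs K·K^M.
  root-arith : ∀ {w X s A} → w ≤ K → w * X + (s * (K * X) + A) ≤ suc s * (K * X) + A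
  root-arith {w} {X} {s} {A} w≤K = begin
    w * X + (s * (K * X) + A)   ≤⟨ +-monoˡ-≤ (s * (K * X) + A) (*-monoˡ-≤ X w≤K) ⟩
    K * X + (s * (K * X) + A)   ≡⟨ +-assoc (K * X) (s * (K * X)) A ⟨
    suc s * (K * X) + A         ∎
    where open ≤-Reasoning

  mutual
    depth-claim : ∀ M {A s w} → Weighted M A s w → DepthBounded (w * K ^ M + A) s
    depth-claim M (piece bounded) = bounded
    depth-claim M (node ws chains args) = node-bound M ws chains λ i → depth-claim M (args i)

    node-bound : ∀ M {A g} {ss : Vec Term (ar g)} (ws : Vec ℕ (ar g)) →
      (Defined R g → ChainsBelow M (fun g ss)) →
      (∀ i → DepthBounded (lookup ws i * K ^ M + A) (lookup ss i)) →
      DepthBounded (suc (sum ws) * K ^ M + A) (fun g ss)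
    node-bound M ws chains args red with root-view red refl
    ... | below-root {us} refl steps = dps-lub us λ i →
          ≤-trans (s≤s (args i (args-reduce steps i))) (below-root-arith (lookup≤sum ws i) (m^n>0 K M))
    ... | via-root steps mem red′ = root-bound M ws chains args steps mem red′

    -- After the first root step with l → r, weight rσ at level M - 1: the
    -- pieces are the instances of proper subterms of l (they sit inside the
    -- arguments), the nodes are marked by a DP step from the root.
    root-bound : ∀ M {A g} {ss ls : Vec Term (ar g)} {r σ u} (ws : Vec ℕ (ar g)) →
      (Defined R g → ChainsBelow M (fun g ss)) →
      (∀ i → DepthBounded (lookup ws i * K ^ M + A) (lookup ss i)) →
      Star ArgStep ss (subs ls σ) → (fun g ls , r) ∈ R → r ⟨ σ ⟩ ⟶* u →
      dp u ≤ suc (sum ws) * K ^ M + A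
    root-bound zero ws chains _ _ mem _ = ⊥-elim (n≮0 (chains (_ , _ , _ , mem , refl) T♯.done))
    root-bound (suc M) {A = A} {g = g} {ls = ls} {r = r} {σ = σ} ws chains args steps mem red =
      decidable-stable (_ ≤? _) $ do
        w , w≤r , weighted ← Weighting.weighting M A′ (_⊏ fun g ls) r σ inside-lhs (rhs-var⊏lhs mem)
                                                  chain-shortens r (inj₁ refl)
        pure (≤-trans (depth-claim M weighted red) (root-arith {s = sum ws} (≤-trans w≤r (rhs≤K mem))))
      where
      A′ = sum ws * K ^ suc M + A

      inside-lhs : ∀ {v} → v ⊑ r → v ⊏ fun g ls → DepthBounded A′ (v ⟨ σ ⟩)
      inside-lhs _ v⊏l red with ⊏-subst σ v⊏l
      ... | sub m p with VecAny.index m | lookup-index m | star-⊑ p red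
      ... | i | refl | q , red-q , u⊑q =
        ≤-trans (dp-⊑ u⊑q) (≤-trans (args i (args-reduce steps i ◅◅ red-q))
                                     (+-monoˡ-≤ A (*-monoˡ-≤ (K ^ suc M) (lookup≤sum ws i))))

      chain-shortens : ∀ {f vs} → fun f vs ⊑ r → ¬ fun f vs ⊏ fun g ls → Defined R f →
                       ChainsBelow M (fun f vs ⟨ σ ⟩)
      chain-shortens p ¬p⊏l def ch = ≤-pred (chains (_ , _ , _ , mem , refl)
        (T♯.next (T♯.rel (♯-args-reduce steps) (dp-step mem p (_ , _ , refl , def) ¬p⊏l) ε) ch))

  -- If all chains from subterms of t have length ≤ N, then t has a weighting
  -- at levels N + 1 and 0 whose nodes are exactly its non-variable positions.
  initial-weighting : ∀ {N} t → (∀ {v} → v ⊑ t → ∀ {n x} → T♯.Iter (DPrel R) n (v ♯) x → n ≤ N) →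
                      ¬ ¬ ∃ λ w → w ≤ size t × Weighted (suc N) 0 t w
  initial-weighting {N} t short = do
      w , w≤t , weighted ← Weighting.weighting (suc N) 0 IsVar t var var-piece (λ _ → _ , refl) node-ok
                                                t (inj₁ refl)
      pure (w , w≤t , subst (λ s → Weighted (suc N) 0 s w) (subst-id t) weighted)
    where
    IsVar : Term → Set
    IsVar v = ∃ λ x → v ≡ var x

    var-piece : ∀ {v} → v ⊑ t → IsVar v → DepthBounded 0 (v ⟨ var ⟩)
    var-piece _ (x , refl) red = ≤-reflexive (cong dp (var-reducts red))

    node-ok : ∀ {f vs} → fun f vs ⊑ t → ¬ IsVar (fun f vs) → Defined R f →
              ChainsBelow (suc N) (fun f vs ⟨ var ⟩)
    node-ok {f} {vs} p _ _ {n} {x} ch =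
      s≤s (short p (subst (λ s → T♯.Iter (DPrel R) n (s ♯) x) (subst-id (fun f vs)) ch))

module RhsSize (S : Sig) (R : List (Terms.Rule S)) where
  open Terms S

  max-rhs-size : ℕ
  max-rhs-size = max 0 (map (size ∘ proj₂) R)

  rhs≤max : ∀ {l r} → (l , r) ∈ R → size r ≤ max-rhs-size
  rhs≤max mem = All.lookup (xs≤max 0 (map (size ∘ proj₂) R)) (∈-map⁺ (size ∘ proj₂) mem)

lemma5p10 : (S : Sig) (R : List (Terms.Rule S)) → TRS.Terminating S R →
    ∃ λ (d : ℕ) → ∀ (t : Terms.Term S) (N : ℕ) → TRS.IsF S R t N →
      ∀ u → Star (λ a b → TRS._⟶[_]_ S a R b) t u →
        Terms.dp S u ≤ Terms.size S t * 2 ^ (d * (N + 1))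
lemma5p10 S R wf = d , λ t N isF u red → decidable-stable (_ ≤? _) $ do
    w , w≤t , weighted ← initial-weighting t (chains≤f isF)
    pure $ begin
      dp u                         ≤⟨ depth-claim (suc N) weighted red ⟩
      w * K ^ suc N + 0            ≡⟨ +-identityʳ _ ⟩
      w * K ^ suc N                ≤⟨ *-monoˡ-≤ (K ^ suc N) w≤t ⟩
      size t * K ^ suc N           ≡⟨ cong (size t *_) (^-*-assoc 2 d (suc N)) ⟩
      size t * 2 ^ (d * suc N)     ≡⟨ cong (λ k → size t * 2 ^ (d * k)) (+-comm 1 N) ⟩
      size t * 2 ^ (d * (N + 1))   ∎
  where
  open Terms S
  open RhsSize S R
  open MarkedTerms S R wf using (chains≤f)
  open ≤-Reasoning

  d K : ℕ
  d = max-rhs-size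
  K = 2 ^ d

  open DepthBound S R wf K {{m^n≢0 2 d}} (λ mem → ≤-trans (rhs≤max mem) (<⇒≤ (n<2^n d)))
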